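{- Let $r\geq 4$ and let $M_r$ be the matrix indexed by subsets of $[r]$ with $M_r(S,T)=\binom{|S\cap T|}{2}+\binom{|\overline{S}\cap\overline{T}|}{2}$, $\overline{S}=[r]\setminus S$. For four distinct elements $w,x,y,z\in[r]$, define $V\in\mathbb{R}^{\mathcal{P}([r])}$ by $V_T=(T(w)-T(x))(T(y)-T(z))$, where $T(u)=1$ if $u\in T$ and $0$ otherwise. Then $V$ is an eigenvector of $M_r$ with eigenvalue $2^{r-3}$.
   Context: $\mathcal{P}([r])$ is the power set of $[r]=\{1,\ldots,r\}$. -}

module Defs where

open import Data.Nat as ℕ using (ℕ; zero; suc)
open import Data.Nat.Combinatorics using (_C_)
open import Data.Integer as ℤ using (ℤ; +_)
open import Data.Fin using (Fin)
open import Data.Fin.Subset using (Subset; _∩_; ∁; ∣_∣; inside; outside)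
open import Data.Vec using ([]; _∷_; lookup)
open import Data.Bool using (true; false)

sumSubsets : {n : ℕ} → (Subset n → ℤ) → ℤ
sumSubsets {zero} f = f []
sumSubsets {suc n} f = sumSubsets (λ s → f (inside ∷ s)) ℤ.+ sumSubsets (λ s → f (outside ∷ s))

M : (r : ℕ) → Subset r → Subset r → ℤ
M r S T = + (∣ S ∩ T ∣ C 2 ℕ.+ ∣ ∁ S ∩ ∁ T ∣ C 2)

ind : {r : ℕ} → Subset r → Fin r → ℤ
ind T u with lookup T u
... | true = + 1
... | false = + 0

V : {r : ℕ} → (w x y z : Fin r) → Subset r → ℤ
V w x y z T = (ind T w ℤ.- ind T x) ℤ.* (ind T y ℤ.- ind T z)

mulM : (r : ℕ) → (Subset r → ℤ) → Subset r → ℤ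
mulM r v S = sumSubsets (λ T → M r S T ℤ.* v T)

-- Expanding V_T = T(w)T(y) − T(w)T(z) − T(x)T(y) + T(x)T(z) turns (M V)(S) into an alternating
-- combination of the four pair sums Σ_{T ⊇ {a,b}} M(S,T). Summing C(|S ∩ T|, 2) over the T that
-- agree with a fixed pattern on a set D averages C(j + K, 2) with K binomial, and the term
-- C(|S̄ ∩ T̄|, 2) becomes one of the same kind after replacing T by its complement. Hence each pair
-- sum is 2^r / 32 times a quadratic in S(a) + S(b) with leading coefficient 2 whose other
-- coefficients depend only on |S| and r. The alternating combination only sees the leading
-- coefficient and yields 4 (S(w) − S(x)) (S(y) − S(z)) = 4 V_S, so (M V)(S) = 2^(r−3) V_S.

module Submission where

open import Defs
open import Data.Nat using (ℕ; zero; suc; _≤_; _^_; _∸_)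
import Data.Nat as ℕ
import Data.Nat.Properties as ℕₚ
open import Data.Nat.Combinatorics using (_C_; nCk+nC[k+1]≡[n+1]C[k+1]; nC1≡n)
open import Data.Integer using (ℤ; +_; _+_; _-_; _*_)
import Data.Integer.Properties as ℤₚ
open import Data.Integer.Tactic.RingSolver using (solve-∀)
open import Data.Fin using (Fin; zero; suc)
open import Data.Fin.Subset
  using (Subset; _∩_; _∪_; ∁; ∣_∣; ⁅_⁆; ⊥; ⊤; _∈_; _∉_; inside; outside)
open import Data.Fin.Subset.Properties
  using (∩-idem; ∩-comm; ∩-identityˡ; ∩-inverseʳ; ∩-zeroʳ; ∪-identityˡ; ∪-identityʳ;
         ∣⊥∣≡0; ∣∁p∣≡n∸∣p∣; ∣p∣≤n; ∈⊤; x∈⁅x⁆; x∈⁅y⁆⇒x≡y; x∈p∪q⁺; x∈p∪q⁻)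
open import Data.Vec using ([]; _∷_; lookup)
open import Data.Vec.Properties using ([]=⇒lookup; lookup⇒[]=)
open import Data.Bool.Properties using (∧-zeroʳ)
open import Data.Product using (_×_; ∃; _,_)
open import Data.Sum using (inj₁; inj₂)
open import Data.Empty using (⊥-elim)
open import Function using (_∘_)
open import Relation.Binary.PropositionalEquality
  using (_≡_; _≢_; refl; sym; trans; cong; cong₂; module ≡-Reasoning)
open ≡-Reasoning

sumSubsets-cong : ∀ {n} {f g : Subset n → ℤ} → (∀ T → f T ≡ g T) → sumSubsets f ≡ sumSubsets g
sumSubsets-cong {zero}  f≗g = f≗g []
sumSubsets-cong {suc n} f≗g =
  cong₂ _+_ (sumSubsets-cong (f≗g ∘ (inside ∷_))) (sumSubsets-cong (f≗g ∘ (outside ∷_)))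

sumSubsets-0 : ∀ n → sumSubsets {n} (λ _ → + 0) ≡ + 0
sumSubsets-0 zero    = refl
sumSubsets-0 (suc n) = cong₂ _+_ (sumSubsets-0 n) (sumSubsets-0 n)

sumSubsets-interchange : ∀ (_∙_ : ℤ → ℤ → ℤ) →
  (∀ a b c d → (a ∙ b) + (c ∙ d) ≡ (a + c) ∙ (b + d)) →
  ∀ {n} (f g : Subset n → ℤ) → sumSubsets (λ T → f T ∙ g T) ≡ sumSubsets f ∙ sumSubsets g
sumSubsets-interchange _∙_ interchange {zero}  f g = refl
sumSubsets-interchange _∙_ interchange {suc n} f g = begin
  sumSubsets (λ T → fᵢ T ∙ gᵢ T) + sumSubsets (λ T → fₒ T ∙ gₒ T)
    ≡⟨ cong₂ _+_ (sumSubsets-interchange _∙_ interchange fᵢ gᵢ)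
                 (sumSubsets-interchange _∙_ interchange fₒ gₒ) ⟩
  (sumSubsets fᵢ ∙ sumSubsets gᵢ) + (sumSubsets fₒ ∙ sumSubsets gₒ)
    ≡⟨ interchange _ _ _ _ ⟩
  sumSubsets f ∙ sumSubsets g ∎
  where
  fᵢ = f ∘ (inside ∷_)
  gᵢ = g ∘ (inside ∷_)
  fₒ = f ∘ (outside ∷_)
  gₒ = g ∘ (outside ∷_)

sumSubsets-+ : ∀ {n} (f g : Subset n → ℤ) → sumSubsets (λ T → f T + g T) ≡ sumSubsets f + sumSubsets g
sumSubsets-+ = sumSubsets-interchange _+_ solve-∀

sumSubsets-- : ∀ {n} (f g : Subset n → ℤ) → sumSubsets (λ T → f T - g T) ≡ sumSubsets f - sumSubsets g
sumSubsets-- = sumSubsets-interchange _-_ solve-∀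

sumSubsets-∁ : ∀ {n} (f : Subset n → ℤ) → sumSubsets f ≡ sumSubsets (f ∘ ∁)
sumSubsets-∁ {zero}  f = refl
sumSubsets-∁ {suc n} f = begin
  sumSubsets (f ∘ (inside ∷_)) + sumSubsets (f ∘ (outside ∷_))
    ≡⟨ cong₂ _+_ (sumSubsets-∁ (f ∘ (inside ∷_))) (sumSubsets-∁ (f ∘ (outside ∷_))) ⟩
  sumSubsets (f ∘ (inside ∷_) ∘ ∁) + sumSubsets (f ∘ (outside ∷_) ∘ ∁)
    ≡⟨ ℤₚ.+-comm (sumSubsets (f ∘ (inside ∷_) ∘ ∁)) _ ⟩
  sumSubsets (f ∘ ∁ ∘ (inside ∷_)) + sumSubsets (f ∘ ∁ ∘ (outside ∷_)) ∎

choose₂ : ℕ → ℤ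
choose₂ k = + (k C 2)

double-choose₂ : ∀ k → + 2 * choose₂ k ≡ + k * (+ k - + 1)
double-choose₂ zero    = refl
double-choose₂ (suc k) = begin
  + 2 * + (suc k C 2)          ≡⟨ cong (λ c → + 2 * + c) (sym (nCk+nC[k+1]≡[n+1]C[k+1] k 1)) ⟩
  + 2 * + (k C 1 ℕ.+ k C 2)    ≡⟨ cong (λ c → + 2 * (+ c + choose₂ k)) (nC1≡n k) ⟩
  + 2 * (+ k + choose₂ k)      ≡⟨ ℤₚ.*-distribˡ-+ (+ 2) (+ k) (choose₂ k) ⟩
  + 2 * + k + + 2 * choose₂ k  ≡⟨ cong (λ t → + 2 * + k + t) (double-choose₂ k) ⟩
  + 2 * + k + + k * (+ k - + 1) ≡⟨ lemma (+ k) ⟩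
  (+ 1 + + k) * ((+ 1 + + k) - + 1) ∎
  where
  lemma : ∀ x → + 2 * x + x * (x - + 1) ≡ (+ 1 + x) * ((+ 1 + x) - + 1)
  lemma = solve-∀

-- 8 𝔼 C(j + K, 2) for K ~ Binomial(m, 1/2).
meanChoose₂ : ℤ → ℤ → ℤ
meanChoose₂ j m = + 4 * (j * (j - + 1)) + + 4 * (j * m) + m * (m - + 1)

meanChoose₂-step : ∀ j m → meanChoose₂ (+ 1 + j) m + meanChoose₂ j m ≡ + 2 * meanChoose₂ j (+ 1 + m)
meanChoose₂-step = polynomial-identity
  where
  polynomial-identity : ∀ j m →
    (+ 4 * ((+ 1 + j) * ((+ 1 + j) - + 1)) + + 4 * ((+ 1 + j) * m) + m * (m - + 1))
      + (+ 4 * (j * (j - + 1)) + + 4 * (j * m) + m * (m - + 1))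
    ≡ + 2 * (+ 4 * (j * (j - + 1)) + + 4 * (j * (+ 1 + m)) + (+ 1 + m) * ((+ 1 + m) - + 1))
  polynomial-identity = solve-∀

meanChoose₂-0 : ∀ k → + 8 * choose₂ k ≡ meanChoose₂ (+ k) (+ 0)
meanChoose₂-0 k = begin
  + 8 * choose₂ k               ≡⟨ ℤₚ.*-assoc (+ 4) (+ 2) (choose₂ k) ⟩
  + 4 * (+ 2 * choose₂ k)       ≡⟨ cong (+ 4 *_) (double-choose₂ k) ⟩
  + 4 * (+ k * (+ k - + 1))     ≡⟨ lemma (+ k) ⟩
  meanChoose₂ (+ k) (+ 0) ∎
  where
  lemma : ∀ x → + 4 * (x * (x - + 1)) ≡ + 4 * (x * (x - + 1)) + + 4 * (x * + 0) + + 0 * (+ 0 - + 1)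
  lemma = solve-∀

agreeOn : ∀ {n} → Subset n → Subset n → Subset n → ℤ
agreeOn []            []            []            = + 1
agreeOn (outside ∷ D) (_       ∷ P) (_       ∷ T) = agreeOn D P T
agreeOn (inside  ∷ D) (inside  ∷ P) (inside  ∷ T) = agreeOn D P T
agreeOn (inside  ∷ D) (inside  ∷ P) (outside ∷ T) = + 0
agreeOn (inside  ∷ D) (outside ∷ P) (inside  ∷ T) = + 0
agreeOn (inside  ∷ D) (outside ∷ P) (outside ∷ T) = agreeOn D P T

agreeOn-∁ : ∀ {n} (D P T : Subset n) → agreeOn D (∁ P) (∁ T) ≡ agreeOn D P T
agreeOn-∁ []            []            []            = refl
agreeOn-∁ (outside ∷ D) (_       ∷ P) (_       ∷ T) = agreeOn-∁ D P T
agreeOn-∁ (inside  ∷ D) (inside  ∷ P) (inside  ∷ T) = agreeOn-∁ D P T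
agreeOn-∁ (inside  ∷ D) (inside  ∷ P) (outside ∷ T) = refl
agreeOn-∁ (inside  ∷ D) (outside ∷ P) (inside  ∷ T) = refl
agreeOn-∁ (inside  ∷ D) (outside ∷ P) (outside ∷ T) = agreeOn-∁ D P T

agreeSum : ∀ {n} → (D P A : Subset n) → ℕ → ℤ
agreeSum D P A u = sumSubsets (λ T → agreeOn D P T * choose₂ (u ℕ.+ ∣ A ∩ T ∣))

agreeSum-suc : ∀ {n} (D P A : Subset n) u →
  sumSubsets (λ T → agreeOn D P T * choose₂ (u ℕ.+ suc ∣ A ∩ T ∣)) ≡ agreeSum D P A (suc u)
agreeSum-suc D P A u =
  sumSubsets-cong (λ T → cong (λ k → agreeOn D P T * choose₂ k) (ℕₚ.+-suc u ∣ A ∩ T ∣))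

free-coordinate-∈ : ∀ (c X Y : ℤ) (N : ℕ) j m →
  c * X ≡ + N * meanChoose₂ (+ 1 + j) m → c * Y ≡ + N * meanChoose₂ j m →
  c * (X + Y) ≡ + (2 ℕ.* N) * meanChoose₂ j (+ 1 + m)
free-coordinate-∈ c X Y N j m cX cY = begin
  c * (X + Y)                                           ≡⟨ ℤₚ.*-distribˡ-+ c X Y ⟩
  c * X + c * Y                                         ≡⟨ cong₂ _+_ cX cY ⟩
  + N * meanChoose₂ (+ 1 + j) m + + N * meanChoose₂ j m ≡⟨ ℤₚ.*-distribˡ-+ (+ N) _ _ ⟨
  + N * (meanChoose₂ (+ 1 + j) m + meanChoose₂ j m)     ≡⟨ cong (+ N *_) (meanChoose₂-step j m) ⟩
  + N * (+ 2 * meanChoose₂ j (+ 1 + m))                 ≡⟨ lemma (+ N) _ ⟩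
  + 2 * + N * meanChoose₂ j (+ 1 + m)                   ≡⟨ cong (_* _) (ℤₚ.pos-* 2 N) ⟨
  + (2 ℕ.* N) * meanChoose₂ j (+ 1 + m) ∎
  where
  lemma : ∀ n e → n * (+ 2 * e) ≡ + 2 * n * e
  lemma = solve-∀

free-coordinate-∉ : ∀ (c X : ℤ) (N : ℕ) e → c * X ≡ + N * e → c * (X + X) ≡ + (2 ℕ.* N) * e
free-coordinate-∉ c X N e cX = begin
  c * (X + X)             ≡⟨ ℤₚ.*-distribˡ-+ c X X ⟩
  c * X + c * X           ≡⟨ cong₂ _+_ cX cX ⟩
  + N * e + + N * e       ≡⟨ lemma (+ N) e ⟩
  + 2 * + N * e           ≡⟨ cong (_* e) (ℤₚ.pos-* 2 N) ⟨
  + (2 ℕ.* N) * e ∎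
  where
  lemma : ∀ n e → n * e + n * e ≡ + 2 * n * e
  lemma = solve-∀

fixed-coordinate : ∀ (a N : ℕ) (X Y e : ℤ) → + 8 * + a * X ≡ + N * e → Y ≡ X →
  + 8 * + (2 ℕ.* a) * Y ≡ + (2 ℕ.* N) * e
fixed-coordinate a N X Y e aX refl = begin
  + 8 * + (2 ℕ.* a) * X   ≡⟨ cong (λ b → + 8 * b * X) (ℤₚ.pos-* 2 a) ⟩
  + 8 * (+ 2 * + a) * X   ≡⟨ lemma (+ a) X ⟩
  + 2 * (+ 8 * + a * X)   ≡⟨ cong (+ 2 *_) aX ⟩
  + 2 * (+ N * e)         ≡⟨ ℤₚ.*-assoc (+ 2) (+ N) e ⟨
  + 2 * + N * e           ≡⟨ cong (_* e) (ℤₚ.pos-* 2 N) ⟨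
  + (2 ℕ.* N) * e ∎
  where
  lemma : ∀ a x → + 8 * (+ 2 * a) * x ≡ + 2 * (+ 8 * a * x)
  lemma = solve-∀

agreeSum-closed : ∀ {n} (D P A : Subset n) u →
  + 8 * + (2 ^ ∣ D ∣) * agreeSum D P A u
    ≡ + (2 ^ n) * meanChoose₂ (+ (u ℕ.+ ∣ A ∩ (D ∩ P) ∣)) (+ ∣ A ∩ ∁ D ∣)
agreeSum-closed [] [] [] u = begin
  + 8 * + 1 * (+ 1 * choose₂ (u ℕ.+ 0))   ≡⟨ cong₂ _*_ (ℤₚ.*-identityʳ (+ 8)) (ℤₚ.*-identityˡ _) ⟩
  + 8 * choose₂ (u ℕ.+ 0)                 ≡⟨ meanChoose₂-0 (u ℕ.+ 0) ⟩
  meanChoose₂ (+ (u ℕ.+ 0)) (+ 0)         ≡⟨ ℤₚ.*-identityˡ _ ⟨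
  + 1 * meanChoose₂ (+ (u ℕ.+ 0)) (+ 0) ∎
agreeSum-closed {suc n} (outside ∷ D) (_ ∷ P) (inside ∷ A) u =
  trans (cong (λ X → + 8 * + (2 ^ ∣ D ∣) * (X + agreeSum D P A u)) (agreeSum-suc D P A u))
        (free-coordinate-∈ (+ 8 * + (2 ^ ∣ D ∣)) (agreeSum D P A (suc u)) (agreeSum D P A u) (2 ^ n)
                           (+ (u ℕ.+ ∣ A ∩ (D ∩ P) ∣)) (+ ∣ A ∩ ∁ D ∣)
                           (agreeSum-closed D P A (suc u)) (agreeSum-closed D P A u))
agreeSum-closed {suc n} (outside ∷ D) (_ ∷ P) (outside ∷ A) u =
  free-coordinate-∉ (+ 8 * + (2 ^ ∣ D ∣)) (agreeSum D P A u) (2 ^ n)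
                    (meanChoose₂ (+ (u ℕ.+ ∣ A ∩ (D ∩ P) ∣)) (+ ∣ A ∩ ∁ D ∣))
                    (agreeSum-closed D P A u)
agreeSum-closed {suc n} (inside ∷ D) (inside ∷ P) (inside ∷ A) u =
  fixed-coordinate (2 ^ ∣ D ∣) (2 ^ n) (agreeSum D P A (suc u)) _
    (meanChoose₂ (+ (u ℕ.+ suc ∣ A ∩ (D ∩ P) ∣)) (+ ∣ A ∩ ∁ D ∣))
    (trans (agreeSum-closed D P A (suc u))
           (cong (λ i → + (2 ^ n) * meanChoose₂ (+ i) (+ ∣ A ∩ ∁ D ∣)) (sym (ℕₚ.+-suc u _))))
    (trans (cong₂ _+_ (agreeSum-suc D P A u) (sumSubsets-0 n)) (ℤₚ.+-identityʳ _))
agreeSum-closed {suc n} (inside ∷ D) (inside ∷ P) (outside ∷ A) u =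
  fixed-coordinate (2 ^ ∣ D ∣) (2 ^ n) (agreeSum D P A u) _
    (meanChoose₂ (+ (u ℕ.+ ∣ A ∩ (D ∩ P) ∣)) (+ ∣ A ∩ ∁ D ∣))
    (agreeSum-closed D P A u)
    (trans (cong (λ t → agreeSum D P A u + t) (sumSubsets-0 n)) (ℤₚ.+-identityʳ _))
agreeSum-closed {suc n} (inside ∷ D) (outside ∷ P) (a ∷ A) u rewrite ∧-zeroʳ a =
  fixed-coordinate (2 ^ ∣ D ∣) (2 ^ n) (agreeSum D P A u) _
    (meanChoose₂ (+ (u ℕ.+ ∣ A ∩ (D ∩ P) ∣)) (+ ∣ A ∩ ∁ D ∣))
    (agreeSum-closed D P A u)
    (trans (cong (_+ agreeSum D P A u) (sumSubsets-0 n)) (ℤₚ.+-identityˡ _))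

sumSubsets-M*agreeOn : ∀ r (S D : Subset r) →
  sumSubsets (λ T → M r S T * agreeOn D D T) ≡ agreeSum D D S 0 + agreeSum D (∁ D) (∁ S) 0
sumSubsets-M*agreeOn r S D = begin
  sumSubsets (λ T → M r S T * agreeOn D D T)
    ≡⟨ sumSubsets-cong split-M ⟩
  sumSubsets (λ T → inner T + outer T)
    ≡⟨ sumSubsets-+ inner outer ⟩
  agreeSum D D S 0 + sumSubsets outer
    ≡⟨ cong (λ t → agreeSum D D S 0 + t) outer-complemented ⟩
  agreeSum D D S 0 + agreeSum D (∁ D) (∁ S) 0 ∎
  where
  inner outer : Subset r → ℤ
  inner T = agreeOn D D T * choose₂ ∣ S ∩ T ∣
  outer T = agreeOn D D T * choose₂ ∣ ∁ S ∩ ∁ T ∣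

  split-M : ∀ T → M r S T * agreeOn D D T ≡ inner T + outer T
  split-M T = begin
    + (∣ S ∩ T ∣ C 2 ℕ.+ ∣ ∁ S ∩ ∁ T ∣ C 2) * agreeOn D D T
      ≡⟨ cong (_* agreeOn D D T) (ℤₚ.pos-+ (∣ S ∩ T ∣ C 2) _) ⟩
    (choose₂ (∣ S ∩ T ∣) + choose₂ (∣ ∁ S ∩ ∁ T ∣)) * agreeOn D D T
      ≡⟨ lemma (choose₂ ∣ S ∩ T ∣) (choose₂ ∣ ∁ S ∩ ∁ T ∣) (agreeOn D D T) ⟩
    inner T + outer T ∎
    where
    lemma : ∀ x y g → (x + y) * g ≡ g * x + g * y
    lemma = solve-∀

  outer-complemented : sumSubsets outer ≡ agreeSum D (∁ D) (∁ S) 0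
  outer-complemented = begin
    sumSubsets outer
      ≡⟨ sumSubsets-cong (λ T → cong (_* choose₂ (∣ ∁ S ∩ ∁ T ∣)) (sym (agreeOn-∁ D D T))) ⟩
    sumSubsets (λ T → agreeOn D (∁ D) (∁ T) * choose₂ (∣ ∁ S ∩ ∁ T ∣))
      ≡⟨ sumSubsets-∁ (λ T → agreeOn D (∁ D) T * choose₂ (∣ ∁ S ∩ T ∣)) ⟨
    agreeSum D (∁ D) (∁ S) 0 ∎

ind-suc : ∀ {n} t (T : Subset n) a → ind (t ∷ T) (suc a) ≡ ind T a
ind-suc t T a with lookup T a
... | inside  = refl
... | outside = refl

ind-∈ : ∀ {n} {T : Subset n} {a} → a ∈ T → ind T a ≡ + 1
ind-∈ a∈T rewrite []=⇒lookup a∈T = refl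

ind-∉ : ∀ {n} {T : Subset n} {a} → a ∉ T → ind T a ≡ + 0
ind-∉ {T = T} {a} a∉T with lookup T a in eq
... | inside  = ⊥-elim (a∉T (lookup⇒[]= a T eq))
... | outside = refl

∉⁅⁆∪⁅⁆ : ∀ {n} {a b c : Fin n} → c ≢ a → c ≢ b → c ∉ ⁅ a ⁆ ∪ ⁅ b ⁆
∉⁅⁆∪⁅⁆ {a = a} {b} c≢a c≢b c∈ with x∈p∪q⁻ ⁅ a ⁆ ⁅ b ⁆ c∈
... | inj₁ c∈⁅a⁆ = c≢a (x∈⁅y⁆⇒x≡y a c∈⁅a⁆)
... | inj₂ c∈⁅b⁆ = c≢b (x∈⁅y⁆⇒x≡y b c∈⁅b⁆)

agreeOn-⊥ : ∀ {n} (P T : Subset n) → agreeOn ⊥ P T ≡ + 1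
agreeOn-⊥ []      []      = refl
agreeOn-⊥ (_ ∷ P) (_ ∷ T) = agreeOn-⊥ P T

agreeOn-⁅⁆ : ∀ {n} (a : Fin n) T → agreeOn ⁅ a ⁆ ⁅ a ⁆ T ≡ ind T a
agreeOn-⁅⁆ zero    (inside  ∷ T) = agreeOn-⊥ ⊥ T
agreeOn-⁅⁆ zero    (outside ∷ T) = refl
agreeOn-⁅⁆ (suc a) (t ∷ T)       = trans (agreeOn-⁅⁆ a T) (sym (ind-suc t T a))

agreeOn-⁅⁆∪⁅⁆ : ∀ {n} {a b : Fin n} → a ≢ b → ∀ T →
  agreeOn (⁅ a ⁆ ∪ ⁅ b ⁆) (⁅ a ⁆ ∪ ⁅ b ⁆) T ≡ ind T a * ind T b
agreeOn-⁅⁆∪⁅⁆ {a = zero}  {zero}  a≢b _ = ⊥-elim (a≢b refl)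
agreeOn-⁅⁆∪⁅⁆ {a = zero}  {suc b} _ (inside ∷ T) rewrite ∪-identityˡ ⁅ b ⁆ =
  trans (agreeOn-⁅⁆ b T) (sym (trans (ℤₚ.*-identityˡ _) (ind-suc inside T b)))
agreeOn-⁅⁆∪⁅⁆ {a = zero}  {suc b} _ (outside ∷ T) = refl
agreeOn-⁅⁆∪⁅⁆ {a = suc a} {zero}  _ (inside ∷ T) rewrite ∪-identityʳ ⁅ a ⁆ =
  trans (agreeOn-⁅⁆ a T) (sym (trans (ℤₚ.*-identityʳ _) (ind-suc inside T a)))
agreeOn-⁅⁆∪⁅⁆ {a = suc a} {zero}  _ (outside ∷ T) = sym (ℤₚ.*-zeroʳ (ind (outside ∷ T) (suc a)))
agreeOn-⁅⁆∪⁅⁆ {a = suc a} {suc b} a≢b (t ∷ T) =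
  trans (agreeOn-⁅⁆∪⁅⁆ (a≢b ∘ cong suc) T) (sym (cong₂ _*_ (ind-suc t T a) (ind-suc t T b)))

∣p∩⊥∣≡0 : ∀ {n} (p : Subset n) → ∣ p ∩ ⊥ ∣ ≡ 0
∣p∩⊥∣≡0 {n} p = trans (cong ∣_∣ (∩-zeroʳ p)) (∣⊥∣≡0 n)

∣p∩⁅x⁆∣ : ∀ {n} (p : Subset n) x → + ∣ p ∩ ⁅ x ⁆ ∣ ≡ ind p x
∣p∩⁅x⁆∣ (inside  ∷ p) zero    = cong (λ k → + suc k) (∣p∩⊥∣≡0 p)
∣p∩⁅x⁆∣ (outside ∷ p) zero    = cong +_ (∣p∩⊥∣≡0 p)
∣p∩⁅x⁆∣ (s ∷ p)       (suc x) rewrite ∧-zeroʳ s = trans (∣p∩⁅x⁆∣ p x) (sym (ind-suc s p x))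

∣p∩⁅x⁆∪⁅y⁆∣ : ∀ {n} {x y : Fin n} → x ≢ y → ∀ p → + ∣ p ∩ (⁅ x ⁆ ∪ ⁅ y ⁆) ∣ ≡ ind p x + ind p y
∣p∩⁅x⁆∪⁅y⁆∣ {x = zero}  {zero}  x≢y _ = ⊥-elim (x≢y refl)
∣p∩⁅x⁆∪⁅y⁆∣ {x = zero}  {suc y} _ (inside ∷ p) rewrite ∪-identityˡ ⁅ y ⁆ =
  cong (_+_ (+ 1)) (trans (∣p∩⁅x⁆∣ p y) (sym (ind-suc inside p y)))
∣p∩⁅x⁆∪⁅y⁆∣ {x = zero}  {suc y} _ (outside ∷ p) rewrite ∪-identityˡ ⁅ y ⁆ =
  trans (∣p∩⁅x⁆∣ p y) (sym (trans (ℤₚ.+-identityˡ _) (ind-suc outside p y)))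
∣p∩⁅x⁆∪⁅y⁆∣ {x = suc x} {zero}  _ (inside ∷ p) rewrite ∪-identityʳ ⁅ x ⁆ =
  trans (cong (_+_ (+ 1)) (trans (∣p∩⁅x⁆∣ p x) (sym (ind-suc inside p x))))
        (ℤₚ.+-comm (+ 1) (ind (inside ∷ p) (suc x)))
∣p∩⁅x⁆∪⁅y⁆∣ {x = suc x} {zero}  _ (outside ∷ p) rewrite ∪-identityʳ ⁅ x ⁆ =
  trans (∣p∩⁅x⁆∣ p x) (sym (trans (ℤₚ.+-identityʳ _) (ind-suc outside p x)))
∣p∩⁅x⁆∪⁅y⁆∣ {x = suc x} {suc y} x≢y (s ∷ p) rewrite ∧-zeroʳ s =
  trans (∣p∩⁅x⁆∪⁅y⁆∣ (x≢y ∘ cong suc) p) (sym (cong₂ _+_ (ind-suc s p x) (ind-suc s p y)))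

∣⁅x⁆∪⁅y⁆∣ : ∀ {n} {x y : Fin n} → x ≢ y → ∣ ⁅ x ⁆ ∪ ⁅ y ⁆ ∣ ≡ 2
∣⁅x⁆∪⁅y⁆∣ {x = x} {y} x≢y = ℤₚ.+-injective (begin
  + ∣ ⁅ x ⁆ ∪ ⁅ y ⁆ ∣         ≡⟨ cong (λ p → + ∣ p ∣) (∩-identityˡ (⁅ x ⁆ ∪ ⁅ y ⁆)) ⟨
  + ∣ ⊤ ∩ (⁅ x ⁆ ∪ ⁅ y ⁆) ∣   ≡⟨ ∣p∩⁅x⁆∪⁅y⁆∣ x≢y ⊤ ⟩
  ind ⊤ x + ind ⊤ y           ≡⟨ cong₂ _+_ (ind-∈ {T = ⊤} {x} ∈⊤) (ind-∈ {T = ⊤} {y} ∈⊤) ⟩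
  + 2 ∎)

∣p∩q∣+∣p∩∁q∣≡∣p∣ : ∀ {n} (p q : Subset n) → ∣ p ∩ q ∣ ℕ.+ ∣ p ∩ ∁ q ∣ ≡ ∣ p ∣
∣p∩q∣+∣p∩∁q∣≡∣p∣ []            []            = refl
∣p∩q∣+∣p∩∁q∣≡∣p∣ (inside  ∷ p) (inside  ∷ q) = cong suc (∣p∩q∣+∣p∩∁q∣≡∣p∣ p q)
∣p∩q∣+∣p∩∁q∣≡∣p∣ (inside  ∷ p) (outside ∷ q) =
  trans (ℕₚ.+-suc ∣ p ∩ q ∣ _) (cong suc (∣p∩q∣+∣p∩∁q∣≡∣p∣ p q))
∣p∩q∣+∣p∩∁q∣≡∣p∣ (outside ∷ p) (_       ∷ q) = ∣p∩q∣+∣p∩∁q∣≡∣p∣ p q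

∣p∣+∣∁p∣≡n : ∀ {n} (p : Subset n) → ∣ p ∣ ℕ.+ ∣ ∁ p ∣ ≡ n
∣p∣+∣∁p∣≡n p = trans (cong (∣ p ∣ ℕ.+_) (∣∁p∣≡n∸∣p∣ p)) (ℕₚ.m+[n∸m]≡n (∣p∣≤n p))

m+n≡o⇒+n≡+o-+m : ∀ {m n o} → m ℕ.+ n ≡ o → + n ≡ + o - + m
m+n≡o⇒+n≡+o-+m {m} {n} refl = begin
  + n                 ≡⟨ lemma (+ m) (+ n) ⟩
  (+ m + + n) - + m   ≡⟨ cong (_- + m) (ℤₚ.pos-+ m n) ⟨
  + (m ℕ.+ n) - + m ∎
  where
  lemma : ∀ m n → n ≡ (m + n) - m
  lemma = solve-∀

pairSum : (r : ℕ) → Subset r → Fin r → Fin r → ℤ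
pairSum r S a b = sumSubsets (λ T → M r S T * (ind T a * ind T b))

-- 32 · pairSum r S a b / 2^r in terms of s = |S|, ρ = r and j = S(a) + S(b).
pairSumFormula : ℤ → ℤ → ℤ → ℤ
pairSumFormula s ρ j = meanChoose₂ j (s - j) + meanChoose₂ (+ 0) ((ρ - s) - (+ 2 - j))

pairSum-closed : ∀ r (S : Subset r) {a b} → a ≢ b →
  + 32 * pairSum r S a b ≡ + (2 ^ r) * pairSumFormula (+ ∣ S ∣) (+ r) (ind S a + ind S b)
pairSum-closed r S {a} {b} a≢b = begin
  + 32 * pairSum r S a b
    ≡⟨ cong (+ 32 *_) (trans (sumSubsets-cong (λ T → cong (M r S T *_) (sym (agreeOn-⁅⁆∪⁅⁆ a≢b T))))
                             (sumSubsets-M*agreeOn r S D)) ⟩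
  + 32 * (agreeSum D D S 0 + agreeSum D (∁ D) (∁ S) 0)
    ≡⟨ ℤₚ.*-distribˡ-+ (+ 32) (agreeSum D D S 0) (agreeSum D (∁ D) (∁ S) 0) ⟩
  + 32 * agreeSum D D S 0 + + 32 * agreeSum D (∁ D) (∁ S) 0
    ≡⟨ cong₂ _+_ (trans (32*X≡8*2^∣D∣*X (agreeSum D D S 0)) (agreeSum-closed D D S 0))
                 (trans (32*X≡8*2^∣D∣*X (agreeSum D (∁ D) (∁ S) 0)) (agreeSum-closed D (∁ D) (∁ S) 0)) ⟩
  + (2 ^ r) * meanChoose₂ (+ ∣ S ∩ (D ∩ D) ∣) (+ ∣ S ∩ ∁ D ∣)
    + + (2 ^ r) * meanChoose₂ (+ ∣ ∁ S ∩ (D ∩ ∁ D) ∣) (+ ∣ ∁ S ∩ ∁ D ∣)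
    ≡⟨ ℤₚ.*-distribˡ-+ (+ (2 ^ r)) _ _ ⟨
  + (2 ^ r) * (meanChoose₂ (+ ∣ S ∩ (D ∩ D) ∣) (+ ∣ S ∩ ∁ D ∣)
               + meanChoose₂ (+ ∣ ∁ S ∩ (D ∩ ∁ D) ∣) (+ ∣ ∁ S ∩ ∁ D ∣))
    ≡⟨ cong (λ t → + (2 ^ r) * t)
            (cong₂ _+_ (cong₂ meanChoose₂ ∣S∩D∣ ∣S∩∁D∣) (cong₂ meanChoose₂ ∣∁S∩⊥∣ ∣∁S∩∁D∣)) ⟩
  + (2 ^ r) * pairSumFormula (+ ∣ S ∣) (+ r) j ∎
  where
  D = ⁅ a ⁆ ∪ ⁅ b ⁆
  j = ind S a + ind S b

  32*X≡8*2^∣D∣*X : ∀ X → + 32 * X ≡ + 8 * + (2 ^ ∣ D ∣) * X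
  32*X≡8*2^∣D∣*X X = cong (λ k → + 8 * + (2 ^ k) * X) (sym (∣⁅x⁆∪⁅y⁆∣ a≢b))

  ∣S∩D∣ : + ∣ S ∩ (D ∩ D) ∣ ≡ j
  ∣S∩D∣ = trans (cong (λ p → + ∣ S ∩ p ∣) (∩-idem D)) (∣p∩⁅x⁆∪⁅y⁆∣ a≢b S)

  ∣S∩∁D∣ : + ∣ S ∩ ∁ D ∣ ≡ + ∣ S ∣ - j
  ∣S∩∁D∣ = trans (m+n≡o⇒+n≡+o-+m (∣p∩q∣+∣p∩∁q∣≡∣p∣ S D)) (cong (+ ∣ S ∣ -_) (∣p∩⁅x⁆∪⁅y⁆∣ a≢b S))

  ∣∁S∩⊥∣ : + ∣ ∁ S ∩ (D ∩ ∁ D) ∣ ≡ + 0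
  ∣∁S∩⊥∣ = cong +_ (trans (cong (λ p → ∣ ∁ S ∩ p ∣) (∩-inverseʳ D)) (∣p∩⊥∣≡0 (∁ S)))

  ∣∁S∩D∣ : + ∣ ∁ S ∩ D ∣ ≡ + 2 - j
  ∣∁S∩D∣ = begin
    + ∣ ∁ S ∩ D ∣           ≡⟨ cong (λ p → + ∣ p ∣) (∩-comm (∁ S) D) ⟩
    + ∣ D ∩ ∁ S ∣           ≡⟨ m+n≡o⇒+n≡+o-+m (∣p∩q∣+∣p∩∁q∣≡∣p∣ D S) ⟩
    + ∣ D ∣ - + ∣ D ∩ S ∣   ≡⟨ cong₂ (λ k p → + k - + ∣ p ∣) (∣⁅x⁆∪⁅y⁆∣ a≢b) (∩-comm D S) ⟩
    + 2 - + ∣ S ∩ D ∣       ≡⟨ cong (+ 2 -_) (∣p∩⁅x⁆∪⁅y⁆∣ a≢b S) ⟩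
    + 2 - j ∎

  ∣∁S∩∁D∣ : + ∣ ∁ S ∩ ∁ D ∣ ≡ (+ r - + ∣ S ∣) - (+ 2 - j)
  ∣∁S∩∁D∣ = trans (m+n≡o⇒+n≡+o-+m (∣p∩q∣+∣p∩∁q∣≡∣p∣ (∁ S) D))
                  (cong₂ _-_ (m+n≡o⇒+n≡+o-+m (∣p∣+∣∁p∣≡n S)) ∣∁S∩D∣)

mulM-V : ∀ r (w x y z : Fin r) S →
  mulM r (V w x y z) S ≡ (pairSum r S w y - pairSum r S w z) - (pairSum r S x y - pairSum r S x z)
mulM-V r w x y z S = begin
  mulM r (V w x y z) S
    ≡⟨ sumSubsets-cong (λ T → expand (M r S T) (ind T w) (ind T x) (ind T y) (ind T z)) ⟩
  sumSubsets (λ T → (Mᵀ w y T - Mᵀ w z T) - (Mᵀ x y T - Mᵀ x z T))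
    ≡⟨ sumSubsets-- (λ T → Mᵀ w y T - Mᵀ w z T) (λ T → Mᵀ x y T - Mᵀ x z T) ⟩
  sumSubsets (λ T → Mᵀ w y T - Mᵀ w z T) - sumSubsets (λ T → Mᵀ x y T - Mᵀ x z T)
    ≡⟨ cong₂ _-_ (sumSubsets-- (Mᵀ w y) (Mᵀ w z)) (sumSubsets-- (Mᵀ x y) (Mᵀ x z)) ⟩
  (pairSum r S w y - pairSum r S w z) - (pairSum r S x y - pairSum r S x z) ∎
  where
  Mᵀ : Fin r → Fin r → Subset r → ℤ
  Mᵀ a b T = M r S T * (ind T a * ind T b)

  expand : ∀ m w x y z →
    m * ((w - x) * (y - z)) ≡ (m * (w * y) - m * (w * z)) - (m * (x * y) - m * (x * z))
  expand = solve-∀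

pairSumFormula-second-difference : ∀ s ρ a b c d →
  (pairSumFormula s ρ (a + c) - pairSumFormula s ρ (a + d))
    - (pairSumFormula s ρ (b + c) - pairSumFormula s ρ (b + d))
  ≡ + 4 * ((a - b) * (c - d))
pairSumFormula-second-difference s ρ a b c d = begin
  (Φ (a + c) - Φ (a + d)) - (Φ (b + c) - Φ (b + d))
    ≡⟨ cong₂ _-_ (cong₂ _-_ (quadratic (a + c)) (quadratic (a + d)))
                 (cong₂ _-_ (quadratic (b + c)) (quadratic (b + d))) ⟩
  ((q (a + c) - q (a + d)) - (q (b + c) - q (b + d)))
    ≡⟨ second-difference (+ 2 * ρ - + 8) (s * (s - + 1) + (ρ - s - + 2) * (ρ - s - + 3)) a b c d ⟩
  + 4 * ((a - b) * (c - d)) ∎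
  where
  Φ = pairSumFormula s ρ
  q : ℤ → ℤ
  q j = + 2 * (j * j) + (+ 2 * ρ - + 8) * j + (s * (s - + 1) + (ρ - s - + 2) * (ρ - s - + 3))

  quadratic : ∀ j → Φ j ≡ q j
  quadratic j = polynomial-identity s ρ j
    where
    polynomial-identity : ∀ s ρ j →
      (+ 4 * (j * (j - + 1)) + + 4 * (j * (s - j)) + (s - j) * ((s - j) - + 1))
        + (+ 4 * (+ 0 * (+ 0 - + 1)) + + 4 * (+ 0 * ((ρ - s) - (+ 2 - j)))
           + ((ρ - s) - (+ 2 - j)) * (((ρ - s) - (+ 2 - j)) - + 1))
      ≡ + 2 * (j * j) + (+ 2 * ρ - + 8) * j + (s * (s - + 1) + (ρ - s - + 2) * (ρ - s - + 3))
    polynomial-identity = solve-∀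

  second-difference : ∀ β γ a b c d →
    ((+ 2 * ((a + c) * (a + c)) + β * (a + c) + γ) - (+ 2 * ((a + d) * (a + d)) + β * (a + d) + γ))
      - ((+ 2 * ((b + c) * (b + c)) + β * (b + c) + γ) - (+ 2 * ((b + d) * (b + d)) + β * (b + d) + γ))
    ≡ + 4 * ((a - b) * (c - d))
  second-difference = solve-∀

*-second-difference : ∀ (k N : ℤ) {a b c d α β γ δ : ℤ} →
  k * a ≡ N * α → k * b ≡ N * β → k * c ≡ N * γ → k * d ≡ N * δ →
  k * ((a - b) - (c - d)) ≡ N * ((α - β) - (γ - δ))
*-second-difference k N {a} {b} {c} {d} {α} {β} {γ} {δ} ka kb kc kd = begin
  k * ((a - b) - (c - d))               ≡⟨ distrib k a b c d ⟩
  (k * a - k * b) - (k * c - k * d)     ≡⟨ cong₂ _-_ (cong₂ _-_ ka kb) (cong₂ _-_ kc kd) ⟩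
  (N * α - N * β) - (N * γ - N * δ)     ≡⟨ distrib N α β γ δ ⟨
  N * ((α - β) - (γ - δ)) ∎
  where
  distrib : ∀ k a b c d → k * ((a - b) - (c - d)) ≡ (k * a - k * b) - (k * c - k * d)
  distrib = solve-∀

2^r≡8*2^[r∸3] : ∀ {r} → 3 ≤ r → + (2 ^ r) ≡ + 8 * + (2 ^ (r ∸ 3))
2^r≡8*2^[r∸3] {r} 3≤r = begin
  + (2 ^ r)                  ≡⟨ cong (λ k → + (2 ^ k)) (ℕₚ.m∸n+n≡m 3≤r) ⟨
  + (2 ^ (r ∸ 3 ℕ.+ 3))       ≡⟨ cong +_ (ℕₚ.^-distribˡ-+-* 2 (r ∸ 3) 3) ⟩
  + (2 ^ (r ∸ 3) ℕ.* 8)       ≡⟨ cong +_ (ℕₚ.*-comm (2 ^ (r ∸ 3)) 8) ⟩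
  + (8 ℕ.* 2 ^ (r ∸ 3))       ≡⟨ ℤₚ.pos-* 8 (2 ^ (r ∸ 3)) ⟩
  + 8 * + (2 ^ (r ∸ 3)) ∎

V-⁅w⁆∪⁅y⁆ : ∀ {r} (w x y z : Fin r) → x ≢ w → x ≢ y → z ≢ w → z ≢ y →
  V w x y z (⁅ w ⁆ ∪ ⁅ y ⁆) ≡ + 1
V-⁅w⁆∪⁅y⁆ w x y z x≢w x≢y z≢w z≢y
  rewrite ind-∈ {T = ⁅ w ⁆ ∪ ⁅ y ⁆} (x∈p∪q⁺ (inj₁ (x∈⁅x⁆ w)))
        | ind-∈ {T = ⁅ w ⁆ ∪ ⁅ y ⁆} (x∈p∪q⁺ (inj₂ (x∈⁅x⁆ y)))
        | ind-∉ (∉⁅⁆∪⁅⁆ x≢w x≢y)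
        | ind-∉ (∉⁅⁆∪⁅⁆ z≢w z≢y)
        = refl

proposition5 : (r : ℕ) → 4 ≤ r → (w x y z : Fin r) →
    w ≢ x → w ≢ y → w ≢ z → x ≢ y → x ≢ z → y ≢ z →
    (∃ λ (T : Subset r) → V w x y z T ≢ + 0) ×
    ((S : Subset r) → mulM r (V w x y z) S ≡ + (2 ^ (r ∸ 3)) * V w x y z S)
proposition5 r 4≤r w x y z w≢x w≢y w≢z x≢y x≢z y≢z =
  (⁅ w ⁆ ∪ ⁅ y ⁆ , V≢0) , λ S → ℤₚ.*-cancelˡ-≡ (+ 32) _ _ (eigen S)
  where
  V≢0 : V w x y z (⁅ w ⁆ ∪ ⁅ y ⁆) ≢ + 0
  V≢0 V≡0 with trans (sym (V-⁅w⁆∪⁅y⁆ w x y z (w≢x ∘ sym) x≢y (w≢z ∘ sym) (y≢z ∘ sym))) V≡0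
  ... | ()

  Y = + (2 ^ (r ∸ 3))
  eigen : ∀ S → + 32 * mulM r (V w x y z) S ≡ + 32 * (Y * V w x y z S)
  eigen S = begin
    + 32 * mulM r (V w x y z) S
      ≡⟨ cong (+ 32 *_) (mulM-V r w x y z S) ⟩
    + 32 * ((pairSum r S w y - pairSum r S w z) - (pairSum r S x y - pairSum r S x z))
      ≡⟨ *-second-difference (+ 32) (+ (2 ^ r)) (closed w≢y) (closed w≢z) (closed x≢y) (closed x≢z) ⟩
    + (2 ^ r) * ((Φ (ind S w + ind S y) - Φ (ind S w + ind S z))
                  - (Φ (ind S x + ind S y) - Φ (ind S x + ind S z)))
      ≡⟨ cong₂ _*_ (2^r≡8*2^[r∸3] (ℕₚ.<⇒≤ 4≤r))
                   (pairSumFormula-second-difference (+ ∣ S ∣) (+ r) (ind S w) (ind S x) (ind S y) (ind S z)) ⟩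
    + 8 * Y * (+ 4 * V w x y z S)
      ≡⟨ lemma Y (V w x y z S) ⟩
    + 32 * (Y * V w x y z S) ∎
    where
    Φ = pairSumFormula (+ ∣ S ∣) (+ r)
    closed : ∀ {a b} → a ≢ b → + 32 * pairSum r S a b ≡ + (2 ^ r) * Φ (ind S a + ind S b)
    closed = pairSum-closed r S
    lemma : ∀ y v → + 8 * y * (+ 4 * v) ≡ + 32 * (y * v)
    lemma = solve-∀
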